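{- Let $G=(V,E,\ell)$ be a labeled DAG and $Q\in\Sigma^+$ a query string, and let $A$ be the set of all node MEMs between $Q$ and $G$. Then for every MEM $([x..y],(i,P,j))$ between $G$ and $Q$ there is a perfect chain $A'[1..p]\subseteq A$ such that $A'[1]\cdot A'[2]\cdots A'[p]=([x..y],(i,P,j))$.
   Context: Strings are over a finite alphabet $\Sigma$; $T[x..y]$ denotes a substring (empty if $y<x$). A labeled DAG is $G=(V,E,\ell)$ with $\ell:V\to\Sigma^+$; for a node $v$, $\lVert v\rVert=|\ell(v)|$. A path $P=v_1\ldots v_k$ has $(v_t,v_{t+1})\in E$. A substring of $G$ is a triple $(i,P,j)$ with $P=v_1\ldots v_k$ a path, $1\le i\le\lVert v_1\rVert$, $1\le j\le \lVert v_k\rVert$, spelling $\ell(v_1)[i..]\cdot\ell(v_2)\cdots\ell(v_{k-1})\cdot\ell(v_k)[..j]$ (for $k=1$, $\ell(v_1)[i..j]$). A match between $Q$ and $G$ is a pair $([x..y],(i,P,j))$ with $Q[x..y]$ equal to the string spelled by $(i,P,j)$. The left-extension $\mathrm{leftext}(i,P,j)$ is $\{\ell(v_1)[i-1]\}$ if $i>1$ and $\{\ell(u)[\lVert u\rVert] : (u,v_1)\in E\}$ otherwise; the right-extension $\mathrm{rightext}(i,P,j)$ is $\{\ell(v_k)[j+1]\}$ if $j<\lVert v_k\rVert$ and $\{\ell(w)[1] : (v_k,w)\in E\}$ otherwise. Let LeftMax be the condition: $x=1$ or $\mathrm{leftext}(i,P,j)=\emptyset$ or $Q[x-1]\notin\mathrm{leftext}(i,P,j)$;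 RightMax: $y=|Q|$ or $\mathrm{rightext}(i,P,j)=\emptyset$ or $Q[y+1]\notin\mathrm{rightext}(i,P,j)$. A match is a MEM between $Q$ and $G$ if (LeftMax or $|\mathrm{leftext}(i,P,j)|\ge 2$) and (RightMax or $|\mathrm{rightext}(i,P,j)|\ge 2$). A node MEM is a match $([x..y],(i,v,j))$ whose path is a single node $v$ and which satisfies (LeftMax or $i=1$) and (RightMax or $j=\lVert v\rVert$). Two graph substrings $(i,P=u_1\ldots u_k,j)$ and $(i',P'=v_1\ldots v_{k'},j')$ can be concatenated if either $(u_k,v_1)\in E$, $j=\lVert u_k\rVert$, $i'=1$, in which case $(i,P,j)\cdot(i',P',j')=(i,PP',j')$; or $u_k=v_1$ and $i'=j+1$, in which case $(i,P,j)\cdot(i',P',j')=(i,u_1\ldots u_{k-1}v_1\ldots v_{k'},j')$. Two matches $([x..y],(i,P,j))$ and $([x'..y'],(i',P',j'))$ can be concatenated if their graph substrings can and $x'=y+1$, and then their concatenation is $([x..y'],(i,P,j)\cdot(i',P',j'))$. A perfect chain is a sequence $A'[1..p]$ of elements of $A$ such that $A'[t]$ can be concatenated to $A'[t+1]$ for all $1\le t<p$. -}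

module Defs where

open import Data.Nat using (ℕ; zero; suc; _+_; _∸_; _≤_; _<_) public
open import Data.Fin using (Fin) public
open import Data.List using (List; []; _∷_; _++_; length; take; drop) public
open import Data.List.Membership.Propositional using (_∈_) public
open import Data.List.Relation.Unary.All using (All) public
open import Data.List.Relation.Unary.Linked using (Linked) public
open import Data.Maybe using (Maybe; just; nothing) public
open import Data.Product using (Σ; ∃; ∃-syntax; _×_; _,_; proj₁; proj₂) public
open import Data.Sum using (_⊎_; inj₁; inj₂) public
open import Data.Unit using (⊤; tt) public
open import Relation.Nullary using (¬_) public
open import Relation.Binary.PropositionalEquality using (_≡_; _≢_; refl) public

charAt : {A : Set} → List A → ℕ → Maybe A
charAt [] _ = nothing
charAt (a ∷ as) zero = nothing
charAt (a ∷ as) (suc zero) = just a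
charAt (a ∷ as) (suc (suc k)) = charAt as (suc k)

-- sub s a b = s[a..b] (1-based, inclusive; empty if b < a), for a ≥ 1.
sub : {A : Set} → List A → ℕ → ℕ → List A
sub s a b = take (suc b ∸ a) (drop (a ∸ 1) s)

-- a path v ∷ vs  (i.e. v₁ … v_k with v₁ = v) w.r.t. edge list E
IsPathIn : {n : ℕ} → List (Fin n × Fin n) → Fin n → List (Fin n) → Set
IsPathIn E v [] = ⊤
IsPathIn E v (w ∷ ws) = ((v , w) ∈ E) × IsPathIn E w ws

lastN : {n : ℕ} → Fin n → List (Fin n) → Fin n
lastN v [] = v
lastN v (w ∷ ws) = lastN w ws

module _ {σ : ℕ} where

  Char : Set
  Char = Fin σ

  record LabeledDAG : Set where
    field
      n      : ℕ
      E      : List (Fin n × Fin n)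
      ℓ      : Fin n → List Char
      ℓ-nonempty : ∀ v → 1 ≤ length (ℓ v)

      acyclic : ∀ v w ws → ¬ (IsPathIn E v (w ∷ ws) × lastN w ws ≡ v)

    IsPath : Fin n → List (Fin n) → Set
    IsPath = IsPathIn E

    ∥_∥ : Fin n → ℕ
    ∥ v ∥ = length (ℓ v)

    -- the string spelled by a path, tail part ℓ(v₂)⋯ℓ(v_{k-1})·ℓ(v_k)[..j]
    tailSpell : Fin n → List (Fin n) → ℕ → List Char
    tailSpell w [] j = take j (ℓ w)
    tailSpell w (w' ∷ ws) j = ℓ w ++ tailSpell w' ws j

    spell : ℕ → Fin n → List (Fin n) → ℕ → List Char
    spell i v [] j = sub (ℓ v) i j
    spell i v (w ∷ ws) j = drop (i ∸ 1) (ℓ v) ++ tailSpell w ws j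

    -- u₁ … u_{k-1} v₁ … v_{k'}  from  u₁ … u_k  and  v₁ … v_{k'}
    joinDrop : Fin n → List (Fin n) → Fin n → List (Fin n) → Fin n × List (Fin n)
    joinDrop u [] v vs = v , vs
    joinDrop u (u' ∷ us) v vs = u , (proj₁ (joinDrop u' us v vs) ∷ proj₂ (joinDrop u' us v vs))

  -- A (raw) match ([x..y], (i, v ∷ vs, j)) : data only, validity separate.
  record Match (G : LabeledDAG) : Set where
    constructor mkMatch
    open LabeledDAG G
    field
      x y i : ℕ
      v     : Fin n
      vs    : List (Fin n)
      j     : ℕ

  module _ (G : LabeledDAG) where
    open LabeledDAG G

    IsGraphSubstring : ℕ → Fin n → List (Fin n) → ℕ → Set
    IsGraphSubstring i v vs j =
      IsPath v vs × (1 ≤ i) × (i ≤ ∥ v ∥) × (1 ≤ j) × (j ≤ ∥ lastN v vs ∥)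

    module _ (Q : List Char) where

      IsMatch : Match G → Set
      IsMatch m = let open Match m in
        IsGraphSubstring i v vs j × (1 ≤ x) × (x ≤ suc y) × (y ≤ length Q)
        × (sub Q x y ≡ spell i v vs j)

      LeftExt : Match G → Char → Set
      LeftExt m c = let open Match m in
        (1 < i × charAt (ℓ v) (i ∸ 1) ≡ just c)
        ⊎ (¬ (1 < i) × ∃[ u ] ((u , v) ∈ E × charAt (ℓ u) ∥ u ∥ ≡ just c))

      RightExt : Match G → Char → Set
      RightExt m c = let open Match m in
        (j < ∥ lastN v vs ∥ × charAt (ℓ (lastN v vs)) (suc j) ≡ just c)
        ⊎ (¬ (j < ∥ lastN v vs ∥) × ∃[ w ] ((lastN v vs , w) ∈ E × charAt (ℓ w) 1 ≡ just c))

      AtLeastTwo : (Char → Set) → Set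
      AtLeastTwo P = ∃[ c ] ∃[ c' ] (c ≢ c' × P c × P c')

      LeftMax : Match G → Set
      LeftMax m = let open Match m in
        x ≡ 1 ⊎ (∀ c → ¬ LeftExt m c)
              ⊎ (∀ c → charAt Q (x ∸ 1) ≡ just c → ¬ LeftExt m c)

      RightMax : Match G → Set
      RightMax m = let open Match m in
        y ≡ length Q ⊎ (∀ c → ¬ RightExt m c)
                     ⊎ (∀ c → charAt Q (suc y) ≡ just c → ¬ RightExt m c)

      IsMEM : Match G → Set
      IsMEM m = IsMatch m × (LeftMax m ⊎ AtLeastTwo (LeftExt m))
                          × (RightMax m ⊎ AtLeastTwo (RightExt m))

      IsNodeMEM : Match G → Set
      IsNodeMEM m = let open Match m in
        IsMatch m × vs ≡ [] × (LeftMax m ⊎ i ≡ 1) × (RightMax m ⊎ j ≡ ∥ v ∥)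

    data Concat : Match G → Match G → Match G → Set where
      viaEdge : ∀ {x y i u us j y' j' v vs} →
        (lastN u us , v) ∈ E → j ≡ ∥ lastN u us ∥ →
        Concat (mkMatch x y i u us j) (mkMatch (suc y) y' 1 v vs j')
               (mkMatch x y' i u (us ++ (v ∷ vs)) j')
      sameNode : ∀ {x y i u us j y' v vs j'} →
        lastN u us ≡ v →
        Concat (mkMatch x y i u us j) (mkMatch (suc y) y' (suc j) v vs j')
               (mkMatch x y' i (proj₁ (joinDrop u us v vs)) (proj₂ (joinDrop u us v vs)) j')

    CanConcat : Match G → Match G → Set
    CanConcat m₁ m₂ = ∃[ m₃ ] Concat m₁ m₂ m₃

    -- left-to-right product: FoldConcat acc ms r  iff  acc · ms[1] ⋯ ms[last] = r
    data FoldConcat : Match G → List (Match G) → Match G → Set where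
      done : ∀ {acc} → FoldConcat acc [] acc
      step : ∀ {acc m c ms r} → Concat acc m c → FoldConcat c ms r → FoldConcat acc (m ∷ ms) r

    -- A'[1] · A'[2] ⋯ A'[p] = r  for A' = m ∷ ms (p ≥ 1)
    ChainProduct : Match G → List (Match G) → Match G → Set
    ChainProduct m ms r = FoldConcat m ms r

    PerfectChain : Match G → List (Match G) → Set
    PerfectChain m ms = Linked CanConcat (m ∷ ms)

-- Cut the MEM at the boundaries of the nodes on its path. Every inner piece covers a whole
-- node, so it is a node MEM for free. The first and last pieces inherit the left and the
-- right condition of the MEM: a left extension with two distinct characters can only arise
-- at i = 1 (inside a node there is a single preceding character), so the MEM condition on
-- the left becomes "LeftMax or i = 1", and symmetrically on the right. The pieces are glued
-- by the edge rule of concatenation, and their left-to-right product is the MEM.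
module Submission where

open import Defs
open import Data.Nat using (s≤s; z≤n)
open import Data.Nat.Properties
  using (≤-refl; ≤-trans; ≤-antisym; ≤-reflexive; ≮⇒≥; m≤m+n; +-monoʳ-≤; m+[n∸m]≡n; m+n∸m≡n; ∸-+-assoc)
open import Data.List.Properties using (take-all; length-drop; drop-drop; ++-assoc; ∷-injective)
open import Data.List.Relation.Unary.All using ([]; _∷_)
open import Data.List.Relation.Unary.Linked using ([-]; _∷_)
open import Data.Empty using (⊥-elim)
open import Data.Maybe.Properties using (just-injective)
open import Relation.Binary.PropositionalEquality using (sym; trans; cong; subst; subst₂)

module _ {X : Set} where

  take≡++ : (A B s : List X) (k : ℕ) → take k s ≡ A ++ B →
    length A ≤ k × take (length A) s ≡ A × take (k ∸ length A) (drop (length A) s) ≡ B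
  take≡++ []      B s       k       eq = z≤n , refl , eq
  take≡++ (a ∷ A) B []      zero    ()
  take≡++ (a ∷ A) B []      (suc k) ()
  take≡++ (a ∷ A) B (c ∷ s) zero    ()
  take≡++ (a ∷ A) B (c ∷ s) (suc k) eq with ∷-injective eq
  ... | refl , eq′ with take≡++ A B s k eq′
  ... | |A|≤k , takeA , takeB = s≤s |A|≤k , cong (c ∷_) takeA , takeB

  sub≡++ : (s A B : List X) {x y : ℕ} → x ≤ y → sub s (suc x) y ≡ A ++ B →
    x + length A ≤ y × sub s (suc x) (x + length A) ≡ A × sub s (suc (x + length A)) y ≡ B
  sub≡++ s A B {x} {y} x≤y eq with take≡++ A B (drop x s) (y ∸ x) eq
  ... | |A|≤ , takeA , takeB =
    subst (x + length A ≤_) (m+[n∸m]≡n x≤y) (+-monoʳ-≤ x |A|≤) ,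
    subst (λ k → take k (drop x s) ≡ A) (sym (m+n∸m≡n x (length A))) takeA ,
    subst₂ (λ k t → take k t ≡ B) (∸-+-assoc y x (length A)) (drop-drop x (length A) s) takeB

  sub-suffix : (s : List X) (i : ℕ) → sub s (suc i) (length s) ≡ drop i s
  sub-suffix s i = take-all _ (drop i s) (≤-reflexive (length-drop i s))

lastN-++ : {n : ℕ} (v : Fin n) (us : List (Fin n)) (w : Fin n) (ws : List (Fin n)) →
  lastN v (us ++ w ∷ ws) ≡ lastN w ws
lastN-++ v []       w ws = refl
lastN-++ v (u ∷ us) w ws = lastN-++ u us w ws

module _ {σ : ℕ} (G : LabeledDAG {σ}) (Q : List (Fin σ)) where
  open LabeledDAG G

  spell-from-start : (w : Fin n) (ws : List (Fin n)) (j : ℕ) → spell 1 w ws j ≡ tailSpell w ws j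
  spell-from-start w []       j = refl
  spell-from-start w (_ ∷ _) j = refl

  leftExt-unique : ∀ {m c c′} → 1 < Match.i m → LeftExt G Q m c → LeftExt G Q m c′ → c ≡ c′
  leftExt-unique _   (inj₁ (_ , e)) (inj₁ (_ , e′)) = just-injective (trans (sym e) e′)
  leftExt-unique 1<i (inj₁ _)       (inj₂ (1≮i , _)) = ⊥-elim (1≮i 1<i)
  leftExt-unique 1<i (inj₂ (1≮i , _)) _              = ⊥-elim (1≮i 1<i)

  rightExt-unique : ∀ {m c c′} → Match.j m < ∥ lastN (Match.v m) (Match.vs m) ∥ →
    RightExt G Q m c → RightExt G Q m c′ → c ≡ c′
  rightExt-unique _   (inj₁ (_ , e)) (inj₁ (_ , e′)) = just-injective (trans (sym e) e′)
  rightExt-unique j<∥ (inj₁ _)       (inj₂ (j≮∥ , _)) = ⊥-elim (j≮∥ j<∥)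
  rightExt-unique j<∥ (inj₂ (j≮∥ , _)) _              = ⊥-elim (j≮∥ j<∥)

  leftMax-or-start : ∀ m → 1 ≤ Match.i m →
    LeftMax G Q m ⊎ AtLeastTwo G Q (LeftExt G Q m) → LeftMax G Q m ⊎ Match.i m ≡ 1
  leftMax-or-start m _   (inj₁ max) = inj₁ max
  leftMax-or-start m 1≤i (inj₂ (c , c′ , c≢c′ , ext , ext′)) =
    inj₂ (≤-antisym (≮⇒≥ λ 1<i → c≢c′ (leftExt-unique {m} 1<i ext ext′)) 1≤i)

  rightMax-or-end : ∀ m → Match.j m ≤ ∥ lastN (Match.v m) (Match.vs m) ∥ →
    RightMax G Q m ⊎ AtLeastTwo G Q (RightExt G Q m) →
    RightMax G Q m ⊎ Match.j m ≡ ∥ lastN (Match.v m) (Match.vs m) ∥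
  rightMax-or-end m _   (inj₁ max) = inj₁ max
  rightMax-or-end m j≤∥ (inj₂ (c , c′ , c≢c′ , ext , ext′)) =
    inj₂ (≤-antisym j≤∥ (≮⇒≥ λ j<∥ → c≢c′ (rightExt-unique {m} j<∥ ext ext′)))

  isMatch-split : ∀ {x y i v w ws j} → IsMatch G Q (mkMatch (suc x) y (suc i) v (w ∷ ws) j) →
    let y′ = x + length (drop i (ℓ v)) in
    (v , w) ∈ E × IsMatch G Q (mkMatch (suc x) y′ (suc i) v [] ∥ v ∥)
                × IsMatch G Q (mkMatch (suc y′) y 1 w ws j)
  isMatch-split {x} {y} {i} {v} {w} {ws} {j}
    (((e , path) , 1≤i , i≤∥v∥ , 1≤j , j≤∥last∥) , _ , s≤s x≤y , y≤|Q| , eq)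
    with sub≡++ Q (drop i (ℓ v)) (tailSpell w ws j) x≤y eq
  ... | y′≤y , eqHead , eqSuffix =
    e ,
    ((tt , 1≤i , i≤∥v∥ , ℓ-nonempty v , ≤-refl) , s≤s z≤n , s≤s (m≤m+n x _) ,
      ≤-trans y′≤y y≤|Q| , trans eqHead (sym (sub-suffix (ℓ v) i))) ,
    ((path , s≤s z≤n , ℓ-nonempty w , 1≤j , j≤∥last∥) , s≤s z≤n , s≤s y′≤y ,
      y≤|Q| , trans eqSuffix (sym (spell-from-start w ws j)))

  -- acc is the product of the pieces so far and prev its last piece; both end with the
  -- whole node u at position ya of Q, and the match to decompose continues across (u , w).
  boundaryChain : ∀ {xa ya ia va usa xp ip u} w ws {y j} →
    lastN va usa ≡ u → (u , w) ∈ E → IsMatch G Q (mkMatch (suc ya) y 1 w ws j) →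
    RightMax G Q (mkMatch (suc ya) y 1 w ws j) ⊎ j ≡ ∥ lastN w ws ∥ →
    Σ (List (Match G)) λ bs →
      All (IsNodeMEM G Q) bs × Linked (CanConcat G) (mkMatch xp ya ip u [] ∥ u ∥ ∷ bs)
      × FoldConcat G (mkMatch xa ya ia va usa ∥ u ∥) bs (mkMatch xa y ia va (usa ++ w ∷ ws) j)
  boundaryChain w [] refl e isMatch right =
    _ ∷ [] , (isMatch , refl , inj₂ refl , right) ∷ [] ,
    (_ , viaEdge e refl) ∷ [-] , step (viaEdge e refl) done
  boundaryChain {xa} {ya} {ia} {va} {usa} w (w′ ∷ ws) {y} {j} refl e isMatch right
    with isMatch-split isMatch
  ... | e′ , isMatchHead , isMatchSuffix
    with boundaryChain {xa} {ya + ∥ w ∥} {ia} {va} {usa ++ w ∷ []} {suc ya} {1}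
           w′ ws (lastN-++ va usa w []) e′ isMatchSuffix right
  ... | bs , nodeMEMs , linked , product =
    _ ∷ bs , (isMatchHead , refl , inj₂ refl , inj₂ refl) ∷ nodeMEMs ,
    (_ , viaEdge e refl) ∷ linked ,
    step (viaEdge e refl)
      (subst (λ us → FoldConcat G (mkMatch xa (ya + ∥ w ∥) ia va (usa ++ w ∷ []) ∥ w ∥) bs
                                  (mkMatch xa y ia va us j))
             (++-assoc usa (w ∷ []) (w′ ∷ ws)) product)

theorem1 : {σ : ℕ} (G : LabeledDAG {σ}) (Q : List (Fin σ)) → 1 ≤ length Q →
    (m : Match G) → IsMEM G Q m →
    Σ (Match G) λ a → Σ (List (Match G)) λ as →
      All (IsNodeMEM G Q) (a ∷ as) × PerfectChain G a as × ChainProduct G a as m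
theorem1 G Q _ m@(mkMatch _ _ _ _ [] _) (isMatch@((_ , 1≤i , _ , _ , j≤∥v∥) , _) , left , right) =
  m , [] ,
  (isMatch , refl , leftMax-or-start G Q m 1≤i left , rightMax-or-end G Q m j≤∥v∥ right) ∷ [] ,
  [-] , done
-- LeftMax and RightMax only look at the ends of a match, so those of m serve for its first
-- and last piece (definitionally).
theorem1 G Q _ m@(mkMatch (suc _) _ (suc _) _ (w ∷ ws) _)
  (isMatch@((_ , 1≤i , _ , _ , j≤∥last∥) , _) , left , right)
  with isMatch-split G Q isMatch
... | e , isMatchHead , isMatchSuffix
  with boundaryChain G Q w ws refl e isMatchSuffix (rightMax-or-end G Q m j≤∥last∥ right)
... | bs , nodeMEMs , linked , product =
  _ , bs , (isMatchHead , refl , leftMax-or-start G Q m 1≤i left , inj₂ refl) ∷ nodeMEMs ,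
  linked , product
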